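{- Let $q$ be a prime power, let $n$ be a positive integer, let $t$ be a positive divisor of $n$, let $u\geq 1$, and let $f(x)=x^{q^u}\in\mathbb{F}_{q^n}[x]$. Then: (1) $f(x)$ is L-$q^t$-partially scattered if and only if $\gcd(u,n)\mid t$; (2) $f(x)$ is R-$q^t$-partially scattered if and only if $\gcd(u,t)=1$; (3) $f(x)$ is scattered if and only if $\gcd(u,n)=1$.
   Context: An $\mathbb{F}_q$-linearized polynomial over $\mathbb{F}_{q^n}$ is a polynomial $\sum_i a_i x^{q^i}\in\mathbb{F}_{q^n}[x]$. For $t\mid n$, such $f$ is called L-$q^t$-partially scattered (of index $0$) if for all $y,z\in\mathbb{F}_{q^n}^*$, $f(y)/y=f(z)/z$ implies $y/z\in\mathbb{F}_{q^t}$; it is called R-$q^t$-partially scattered (of index $0$) if for all $y,z\in\mathbb{F}_{q^n}^*$, $f(y)/y=f(z)/z$ and $y/z\in\mathbb{F}_{q^t}$ imply $y/z\in\mathbb{F}_q$; it is called scattered (of index $0$) if for all $y,z\in\mathbb{F}_{q^n}^*$, $f(y)/y=f(z)/z$ implies $y/z\in\mathbb{F}_q$. -}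

module Defs where

open import Level using (Level; _⊔_) renaming (suc to lsuc)
open import Algebra.Bundles using (CommutativeRing)
open import Data.Nat using (ℕ; zero; suc; _^_; _≥_)
open import Data.Nat.Primality using (Prime)
open import Data.Fin using (Fin)
open import Data.Product using (Σ; ∃; _×_)
open import Relation.Nullary using (¬_)
open import Relation.Binary.PropositionalEquality using (_≡_)

-- A field: a commutative ring with 1 ≠ 0 in which every nonzero element
-- has a multiplicative inverse (the operation _⁻¹ is total; its value at 0
-- is irrelevant).
record Field (c ℓ : Level) : Set (lsuc (c ⊔ ℓ)) where
  field
    commutativeRing : CommutativeRing c ℓ
  open CommutativeRing commutativeRing public
  field
    _⁻¹        : Carrier → Carrier
    ⁻¹-inverse : ∀ x → ¬ (x ≈ 0#) → (x * (x ⁻¹)) ≈ 1#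
    1≉0        : ¬ (1# ≈ 0#)

module _ {c ℓ : Level} (F : Field c ℓ) where
  open Field F

  pow : Carrier → ℕ → Carrier
  pow x zero    = 1#
  pow x (suc m) = x * pow x m

  HasSize : ℕ → Set (c ⊔ ℓ)
  HasSize N = Σ (Fin N → Carrier) λ e →
                (∀ i j → e i ≈ e j → i ≡ j) × (∀ x → ∃ λ i → e i ≈ x)

  InSubfield : ℕ → ℕ → Carrier → Set ℓ
  InSubfield q k x = pow x (q ^ k) ≈ x

  monomial : ℕ → ℕ → Carrier → Carrier
  monomial q u x = pow x (q ^ u)

  quot : (Carrier → Carrier) → Carrier → Carrier
  quot f y = f y * (y ⁻¹)

  Nonzero : Carrier → Set ℓ
  Nonzero x = ¬ (x ≈ 0#)

  LPartiallyScattered : ℕ → ℕ → (Carrier → Carrier) → Set (c ⊔ ℓ)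
  LPartiallyScattered q t f = ∀ y z → Nonzero y → Nonzero z →
    quot f y ≈ quot f z → InSubfield q t (y * (z ⁻¹))

  RPartiallyScattered : ℕ → ℕ → (Carrier → Carrier) → Set (c ⊔ ℓ)
  RPartiallyScattered q t f = ∀ y z → Nonzero y → Nonzero z →
    quot f y ≈ quot f z → InSubfield q t (y * (z ⁻¹)) →
    InSubfield q 1 (y * (z ⁻¹))

  Scattered : ℕ → (Carrier → Carrier) → Set (c ⊔ ℓ)
  Scattered q f = ∀ y z → Nonzero y → Nonzero z →
    quot f y ≈ quot f z → InSubfield q 1 (y * (z ⁻¹))

IsPrimePower : ℕ → Set
IsPrimePower q = Σ ℕ λ p → Σ ℕ λ k → Prime p × k ≥ 1 × q ≡ p ^ k

-- For nonzero y and z, f(y)/y = f(z)/z says exactly that y/z is fixed by x ↦ x^(q^u), i.e. lies in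
-- 𝔽_{q^u}. Membership in 𝔽_{q^a} and 𝔽_{q^b} gives membership in 𝔽_{q^gcd(a,b)} (Bézout), and every
-- element lies in 𝔽_{q^n} (Fermat); this gives the three "if" directions. Conversely, taking z = 1,
-- each property yields an inclusion of the units of 𝔽_{q^d} in 𝔽_{q^e} for suitable d ∣ n, which
-- forces d ∣ e: otherwise, with g = gcd(d, e) < d, every (q^d − 1)-th root of unity would be a
-- (q^g − 1)-th one, and raising to the power (q^n − 1)/(q^d − 1) would make all q^n − 1 units roots
-- of a polynomial of smaller degree.
module Submission where

open import Defs
open import Data.Nat using (ℕ; _≥_; _^_)
open import Data.Nat.Divisibility using (_∣_)
open import Data.Nat.GCD using (gcd)
open import Data.Product using (_×_)
open import Function.Bundles using (_⇔_)
open import Relation.Binary.PropositionalEquality using (_≡_)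

open import Level using (Level)
open import Data.Nat using (zero; suc; pred; NonZero; >-nonZero)
import Data.Nat as ℕ
import Data.Nat.Properties as ℕ
open import Data.Nat.Divisibility using (divides; ∣⇒≤; ∣-trans; 0∣⇒≡0; ∣1⇒≡1)
open import Data.Nat.Primality using (prime⇒nonTrivial)
open import Data.Nat.GCD using (gcd-GCD; gcd[m,n]∣m; gcd[m,n]∣n; gcd[m,n]≢0; module Bézout)
open import Data.Fin using (Fin; punchIn)
import Data.Fin as Fin
import Data.Fin.Properties as Fin
open import Data.Fin.Permutation using (Permutation; permutation)
open import Data.List using (List; []; _∷_; length; replicate)
open import Data.List.Properties using (length-replicate)
open import Data.Product using (∃-syntax; _,_; proj₁; proj₂)
open import Data.Sum using (inj₁)
open import Data.Empty using (⊥-elim)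
open import Function.Base using (_∘_)
open import Function.Bundles using (mk⇔; module Equivalence)
open import Function.Definitions using (Injective)
open import Relation.Nullary using (¬_; yes; no)
open import Relation.Binary.Definitions using (Decidable)
open import Relation.Binary.PropositionalEquality using (_≢_)
import Relation.Binary.PropositionalEquality as ≡

module FieldProperties {c ℓ : Level} (F : Field c ℓ) where
  open Field F hiding (zero)
  open import Relation.Binary.Reasoning.Setoid setoid
  import Algebra.Properties.CommutativeSemiring.Exp commutativeSemiring as Exp
  open import Algebra.Properties.Group +-group using (x∙y⁻¹≈ε⇒x≈y; x≈y⇒x∙y⁻¹≈ε)
  open import Algebra.Properties.Ring ring using ([y-z]x≈yx-zx)

  pow≡^ : ∀ x n → pow F x n ≡ x Exp.^ n
  pow≡^ x zero    = ≡.refl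
  pow≡^ x (suc n) = ≡.cong (x *_) (pow≡^ x n)

  pow-congˡ : ∀ n {x y} → x ≈ y → pow F x n ≈ pow F y n
  pow-congˡ n {x} {y} x≈y rewrite pow≡^ x n | pow≡^ y n = Exp.^-congˡ n x≈y

  pow-congʳ : ∀ x {m n} → m ≡ n → pow F x m ≈ pow F x n
  pow-congʳ x m≡n = reflexive (≡.cong (pow F x) m≡n)

  pow-assocʳ : ∀ x m n → pow F (pow F x m) n ≈ pow F x (m ℕ.* n)
  pow-assocʳ x m n rewrite pow≡^ (pow F x m) n | pow≡^ x m | pow≡^ x (m ℕ.* n) = Exp.^-assocʳ x m n

  pow-distrib-* : ∀ x y n → pow F (x * y) n ≈ pow F x n * pow F y n
  pow-distrib-* x y n rewrite pow≡^ (x * y) n | pow≡^ x n | pow≡^ y n = Exp.^-distrib-* x y n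

  pow-zeroˡ : ∀ n → pow F 1# n ≈ 1#
  pow-zeroˡ zero    = refl
  pow-zeroˡ (suc n) = trans (*-identityˡ _) (pow-zeroˡ n)

  ⁻¹-inverseˡ : ∀ x → x ≉ 0# → (x ⁻¹) * x ≈ 1#
  ⁻¹-inverseˡ x x≉0 = trans (*-comm _ _) (⁻¹-inverse x x≉0)

  *-cancelˡ : ∀ {x y z} → x ≉ 0# → x * y ≈ x * z → y ≈ z
  *-cancelˡ {x} {y} {z} x≉0 xy≈xz = begin
    y                ≈⟨ *-identityˡ y ⟨
    1# * y           ≈⟨ *-congʳ (⁻¹-inverseˡ x x≉0) ⟨
    ((x ⁻¹) * x) * y ≈⟨ *-assoc _ _ _ ⟩
    (x ⁻¹) * (x * y) ≈⟨ *-congˡ xy≈xz ⟩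
    (x ⁻¹) * (x * z) ≈⟨ *-assoc _ _ _ ⟨
    ((x ⁻¹) * x) * z ≈⟨ *-congʳ (⁻¹-inverseˡ x x≉0) ⟩
    1# * z           ≈⟨ *-identityˡ z ⟩
    z                ∎

  *-cancelʳ : ∀ {x y z} → x ≉ 0# → y * x ≈ z * x → y ≈ z
  *-cancelʳ x≉0 yx≈zx = *-cancelˡ x≉0 (trans (*-comm _ _) (trans yx≈zx (*-comm _ _)))

  *-nonzero : ∀ {x y} → x ≉ 0# → y ≉ 0# → x * y ≉ 0#
  *-nonzero {x} x≉0 y≉0 xy≈0 = y≉0 (*-cancelˡ x≉0 (trans xy≈0 (sym (zeroʳ x))))

  pow-nonzero : ∀ {x} n → x ≉ 0# → pow F x n ≉ 0#
  pow-nonzero zero    x≉0 = 1≉0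
  pow-nonzero (suc n) x≉0 = *-nonzero x≉0 (pow-nonzero n x≉0)

  1⁻¹≈1 : 1# ⁻¹ ≈ 1#
  1⁻¹≈1 = trans (sym (*-identityˡ _)) (⁻¹-inverse 1# 1≉0)

  *-1⁻¹ : ∀ x → x * 1# ⁻¹ ≈ x
  *-1⁻¹ x = trans (*-congˡ 1⁻¹≈1) (*-identityʳ x)

  -‿nonzero : ∀ {x y} → x ≉ y → x - y ≉ 0#
  -‿nonzero {x} {y} x≉y x-y≈0 = x≉y (x∙y⁻¹≈ε⇒x≈y x y x-y≈0)

  *-cancelʳ-≉ : ∀ {x y z} → y ≉ x → x * z ≈ y * z → z ≈ 0#
  *-cancelʳ-≉ {x} {y} {z} y≉x xz≈yz = *-cancelˡ (-‿nonzero y≉x) (begin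
    (y - x) * z       ≈⟨ [y-z]x≈yx-zx z y x ⟩
    y * z - x * z     ≈⟨ x≈y⇒x∙y⁻¹≈ε (sym xz≈yz) ⟩
    0#                ≈⟨ zeroʳ _ ⟨
    (y - x) * 0#      ∎)

  pow-suc≈self⇒pow≈1 : ∀ {x} k → x ≉ 0# → pow F x (suc k) ≈ x → pow F x k ≈ 1#
  pow-suc≈self⇒pow≈1 {x} k x≉0 x^[1+k]≈x = *-cancelˡ x≉0 (trans x^[1+k]≈x (sym (*-identityʳ x)))

  pow≈1⇒pow-suc≈self : ∀ {x} k → pow F x k ≈ 1# → pow F x (suc k) ≈ x
  pow≈1⇒pow-suc≈self {x} k x^k≈1 = trans (*-congˡ x^k≈1) (*-identityʳ x)

-- The list c₀ ∷ … ∷ c_{d-1} stands for the monic polynomial c₀ + c₁ X + ⋯ + c_{d-1} X^{d-1} + X^d.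
module MonicPolynomials {c ℓ : Level} (F : Field c ℓ) where
  open Field F hiding (zero)
  open FieldProperties F
  open import Relation.Binary.Reasoning.Setoid setoid
  open import Algebra.Solver.Ring.NaturalCoefficients.Default commutativeSemiring
    using (solve; _:=_; _:+_; _:*_)

  ⟦_⟧ : List Carrier → Carrier → Carrier
  ⟦ []     ⟧ x = 1#
  ⟦ c ∷ cs ⟧ x = c + x * ⟦ cs ⟧ x

  -- the quotient of ⟦ c ∷ cs ⟧ by X - a, which does not depend on c
  quotient : Carrier → List Carrier → List Carrier
  quotient a []       = []
  quotient a (d ∷ ds) = ⟦ d ∷ ds ⟧ a ∷ quotient a ds

  length-quotient : ∀ a cs → length (quotient a cs) ≡ length cs
  length-quotient a []       = ≡.refl
  length-quotient a (d ∷ ds) = ≡.cong suc (length-quotient a ds)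

  -- p(x) = (x - a) q(x) + p(a), with both sides moved so that no subtraction occurs
  factor-theorem : ∀ a c cs x →
                   ⟦ c ∷ cs ⟧ x + a * ⟦ quotient a cs ⟧ x ≈ x * ⟦ quotient a cs ⟧ x + ⟦ c ∷ cs ⟧ a
  factor-theorem a c [] x =
    solve 4 (λ c x a o → (c :+ x :* o) :+ a :* o := x :* o :+ (c :+ a :* o)) refl c x a 1#
  factor-theorem a c (d ∷ ds) x = begin
    (c + x * p) + a * (r + x * s)   ≈⟨ solve 6 (λ c x a p r s →
                                         (c :+ x :* p) :+ a :* (r :+ x :* s) := (c :+ a :* r) :+ x :* (p :+ a :* s))
                                       refl c x a p r s ⟩
    (c + a * r) + x * (p + a * s)   ≈⟨ +-congˡ (*-congˡ (factor-theorem a d ds x)) ⟩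
    (c + a * r) + x * (x * s + r)   ≈⟨ solve 5 (λ c x a r s →
                                         (c :+ a :* r) :+ x :* (x :* s :+ r) := x :* (r :+ x :* s) :+ (c :+ a :* r))
                                       refl c x a r s ⟩
    x * (r + x * s) + (c + a * r)   ∎
    where
    p r s : Carrier
    p = ⟦ d ∷ ds ⟧ x
    r = ⟦ d ∷ ds ⟧ a
    s = ⟦ quotient a ds ⟧ x

  roots≤degree : ∀ {m} cs (v : Fin m → Carrier) → Injective _≡_ _≈_ v →
                 (∀ i → ⟦ cs ⟧ (v i) ≈ 0#) → m ℕ.≤ length cs
  roots≤degree {zero}  cs       v v-inj roots = ℕ.z≤n
  roots≤degree {suc m} []       v v-inj roots = ⊥-elim (1≉0 (roots Fin.zero))
  roots≤degree {suc m} (c ∷ cs) v v-inj roots = ℕ.s≤s (≡.subst (m ℕ.≤_) (length-quotient a cs)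
    (roots≤degree (quotient a cs) (v ∘ Fin.suc) (Fin.suc-injective ∘ v-inj) quotient-roots))
    where
    a : Carrier
    a = v Fin.zero
    quotient-roots : ∀ i → ⟦ quotient a cs ⟧ (v (Fin.suc i)) ≈ 0#
    quotient-roots i = *-cancelʳ-≉ b≉a (begin
      a * ⟦ quotient a cs ⟧ b                      ≈⟨ +-identityˡ _ ⟨
      0# + a * ⟦ quotient a cs ⟧ b                 ≈⟨ +-congʳ (roots (Fin.suc i)) ⟨
      ⟦ c ∷ cs ⟧ b + a * ⟦ quotient a cs ⟧ b       ≈⟨ factor-theorem a c cs b ⟩
      b * ⟦ quotient a cs ⟧ b + ⟦ c ∷ cs ⟧ a       ≈⟨ +-congˡ (roots Fin.zero) ⟩
      b * ⟦ quotient a cs ⟧ b + 0#                 ≈⟨ +-identityʳ _ ⟩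
      b * ⟦ quotient a cs ⟧ b                      ∎)
      where
      b : Carrier
      b = v (Fin.suc i)
      b≉a : b ≉ a
      b≉a b≈a with v-inj b≈a
      ... | ()

  rootsOfUnity≤exponent : ∀ {m} j (v : Fin m → Carrier) → Injective _≡_ _≈_ v →
                          (∀ i → pow F (v i) (suc j) ≈ 1#) → m ℕ.≤ suc j
  rootsOfUnity≤exponent j v v-inj roots = ≡.subst (λ d → _ ℕ.≤ suc d) (length-replicate j)
    (roots≤degree (- 1# ∷ replicate j 0#) v v-inj λ i → begin
      - 1# + v i * ⟦ replicate j 0# ⟧ (v i)   ≈⟨ +-congˡ (*-congˡ (⟦0ʲ⟧ j (v i))) ⟩
      - 1# + pow F (v i) (suc j)             ≈⟨ +-congˡ (roots i) ⟩
      - 1# + 1#                              ≈⟨ -‿inverseˡ 1# ⟩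
      0#                                     ∎)
    where
    ⟦0ʲ⟧ : ∀ j x → ⟦ replicate j 0# ⟧ x ≈ pow F x j
    ⟦0ʲ⟧ zero    x = refl
    ⟦0ʲ⟧ (suc j) x = trans (+-identityˡ _) (*-congˡ (⟦0ʲ⟧ j x))

module FiniteFields {c ℓ : Level} (F : Field c ℓ) {M : ℕ} (size : HasSize F (suc M)) where
  open Field F hiding (zero)
  open FieldProperties F
  open MonicPolynomials F using (rootsOfUnity≤exponent)
  open import Relation.Binary.Reasoning.Setoid setoid
  import Algebra.Properties.CommutativeMonoid.Sum *-commutativeMonoid as Product

  private
    enum : Fin (suc M) → Carrier
    enum = proj₁ size

    enum-injective : Injective _≡_ _≈_ enum
    enum-injective {i} {j} = proj₁ (proj₂ size) i j

    index : Carrier → Fin (suc M)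
    index x = proj₁ (proj₂ (proj₂ size) x)

    enum-index : ∀ x → enum (index x) ≈ x
    enum-index x = proj₂ (proj₂ (proj₂ size) x)

    ∏ : ∀ {n} → (Fin n → Carrier) → Carrier
    ∏ = Product.sum

    unit : Fin M → Carrier
    unit j = enum (punchIn (index 0#) j)

    unit-nonzero : ∀ j → unit j ≉ 0#
    unit-nonzero j u≈0 = Fin.punchInᵢ≢i (index 0#) j (enum-injective (trans u≈0 (sym (enum-index 0#))))

    unit-injective : Injective _≡_ _≈_ unit
    unit-injective {i} {j} = Fin.punchIn-injective (index 0#) i j ∘ enum-injective

  _≟_ : Decidable _≈_
  x ≟ y with index x Fin.≟ index y
  ... | yes ix≡iy = yes (trans (sym (enum-index x)) (trans (reflexive (≡.cong enum ix≡iy)) (enum-index y)))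
  ... | no  ix≢iy = no (λ x≈y → ix≢iy (enum-injective (trans (enum-index x) (trans x≈y (sym (enum-index y))))))

  order≢0 : M ≢ 0
  order≢0 ≡.refl with index 1# | enum-index 1# | index 0# | enum-index 0#
  ... | Fin.zero | e₁ | Fin.zero | e₀ = 1≉0 (trans (sym e₁) e₀)

  -- Fermat's little theorem is proved by comparing ∏ₓ unitPart x with ∏ₓ unitPart (a x),
  -- where unitPart replaces 0 by 1.
  private
    unitPart : Carrier → Carrier
    unitPart x with x ≟ 0#
    ... | yes _ = 1#
    ... | no  _ = x

    aIfNonzero : Carrier → Carrier → Carrier
    aIfNonzero a x with x ≟ 0#
    ... | yes _ = 1#
    ... | no  _ = a

    unitPart-cong : ∀ {x y} → x ≈ y → unitPart x ≈ unitPart y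
    unitPart-cong {x} {y} x≈y with x ≟ 0# | y ≟ 0#
    ... | yes _   | yes _   = refl
    ... | yes x≈0 | no  y≉0 = ⊥-elim (y≉0 (trans (sym x≈y) x≈0))
    ... | no  x≉0 | yes y≈0 = ⊥-elim (x≉0 (trans x≈y y≈0))
    ... | no  _   | no  _   = x≈y

    unitPart-nonzero : ∀ x → unitPart x ≉ 0#
    unitPart-nonzero x with x ≟ 0#
    ... | yes _   = 1≉0
    ... | no  x≉0 = x≉0

    unitPart-* : ∀ {a} x → a ≉ 0# → unitPart (a * x) ≈ aIfNonzero a x * unitPart x
    unitPart-* {a} x a≉0 with (a * x) ≟ 0# | x ≟ 0#
    ... | yes _    | yes _   = sym (*-identityˡ 1#)
    ... | yes ax≈0 | no  x≉0 = ⊥-elim (*-nonzero a≉0 x≉0 ax≈0)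
    ... | no  ax≉0 | yes x≈0 = ⊥-elim (ax≉0 (trans (*-congˡ x≈0) (zeroʳ a)))
    ... | no  _    | no  _   = refl

    aIfNonzero-≉0 : ∀ {a x} → x ≉ 0# → aIfNonzero a x ≈ a
    aIfNonzero-≉0 {a} {x} x≉0 with x ≟ 0#
    ... | yes x≈0 = ⊥-elim (x≉0 x≈0)
    ... | no  _   = refl

    aIfNonzero-≈0 : ∀ {a x} → x ≈ 0# → aIfNonzero a x ≈ 1#
    aIfNonzero-≈0 {a} {x} x≈0 with x ≟ 0#
    ... | yes _   = refl
    ... | no  x≉0 = ⊥-elim (x≉0 x≈0)

    ∏-nonzero : ∀ {n} (f : Fin n → Carrier) → (∀ i → f i ≉ 0#) → ∏ f ≉ 0#
    ∏-nonzero {zero}  f f≉0 = 1≉0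
    ∏-nonzero {suc n} f f≉0 = *-nonzero (f≉0 Fin.zero) (∏-nonzero (f ∘ Fin.suc) (f≉0 ∘ Fin.suc))

    ∏-const : ∀ {n} (f : Fin n → Carrier) {a} → (∀ i → f i ≈ a) → ∏ f ≈ pow F a n
    ∏-const {zero}  f f≈a = refl
    ∏-const {suc n} f f≈a = *-cong (f≈a Fin.zero) (∏-const (f ∘ Fin.suc) (f≈a ∘ Fin.suc))

    ∏-aIfNonzero : ∀ a → ∏ (λ i → aIfNonzero a (enum i)) ≈ pow F a M
    ∏-aIfNonzero a = begin
      ∏ (λ i → aIfNonzero a (enum i))
        ≈⟨ Product.sum-remove {i = index 0#} (λ i → aIfNonzero a (enum i)) ⟩
      aIfNonzero a (enum (index 0#)) * ∏ (λ j → aIfNonzero a (unit j))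
        ≈⟨ *-cong (aIfNonzero-≈0 (enum-index 0#)) (∏-const _ (λ j → aIfNonzero-≉0 (unit-nonzero j))) ⟩
      1# * pow F a M
        ≈⟨ *-identityˡ _ ⟩
      pow F a M
        ∎

    scaling : ∀ {a b} → a * b ≈ 1# → ∀ i → index (a * enum (index (b * enum i))) ≡ i
    scaling {a} {b} ab≈1 i = enum-injective (begin
      enum (index (a * enum (index (b * enum i))))  ≈⟨ enum-index _ ⟩
      a * enum (index (b * enum i))                 ≈⟨ *-congˡ (enum-index _) ⟩
      a * (b * enum i)                              ≈⟨ *-assoc _ _ _ ⟨
      (a * b) * enum i                              ≈⟨ *-congʳ ab≈1 ⟩
      1# * enum i                                   ≈⟨ *-identityˡ _ ⟩
      enum i                                        ∎)

    multiplication : ∀ {a} → a ≉ 0# → Permutation (suc M) (suc M)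
    multiplication {a} a≉0 = permutation (λ i → index (a * enum i)) (λ i → index ((a ⁻¹) * enum i))
      (scaling (⁻¹-inverse a a≉0)) (scaling (⁻¹-inverseˡ a a≉0))

  pow-order≈1 : ∀ a → a ≉ 0# → pow F a M ≈ 1#
  pow-order≈1 a a≉0 = *-cancelʳ (∏-nonzero (unitPart ∘ enum) (unitPart-nonzero ∘ enum)) (begin
    pow F a M * ∏ (unitPart ∘ enum)
      ≈⟨ *-congʳ (∏-aIfNonzero a) ⟨
    ∏ (λ i → aIfNonzero a (enum i)) * ∏ (unitPart ∘ enum)
      ≈⟨ Product.∑-distrib-+ (λ i → aIfNonzero a (enum i)) (unitPart ∘ enum) ⟨
    ∏ (λ i → aIfNonzero a (enum i) * unitPart (enum i))
      ≈⟨ Product.sum-cong-≋ {x = λ i → unitPart (a * enum i)} (λ i → unitPart-* (enum i) a≉0) ⟨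
    ∏ (λ i → unitPart (a * enum i))
      ≈⟨ Product.sum-cong-≋ {x = λ i → unitPart (enum (index (a * enum i)))} (λ i → unitPart-cong (enum-index _)) ⟨
    ∏ (λ i → unitPart (enum (index (a * enum i))))
      ≈⟨ Product.sum-permute (unitPart ∘ enum) (multiplication a≉0) ⟨
    ∏ (unitPart ∘ enum)
      ≈⟨ *-identityˡ _ ⟨
    1# * ∏ (unitPart ∘ enum)
      ∎)

  pow-size≈self : ∀ x → pow F x (suc M) ≈ x
  pow-size≈self x with x ≟ 0#
  ... | yes x≈0 = trans (*-congʳ x≈0) (trans (zeroˡ _) (sym x≈0))
  ... | no  x≉0 = pow≈1⇒pow-suc≈self M (pow-order≈1 x x≉0)

  order≤exponent : ∀ e → .{{NonZero e}} → (∀ w → w ≉ 0# → pow F w e ≈ 1#) → M ℕ.≤ e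
  order≤exponent (suc j) w^e≈1 =
    rootsOfUnity≤exponent j unit unit-injective (λ i → w^e≈1 (unit i) (unit-nonzero i))

  -- w ↦ w^(M/k) sends units to k-th roots of unity, so all units would be roots of X^((M/k) j) − 1.
  rootsOfUnity-⊈ : ∀ {k j} → k ∣ M → 0 ℕ.< j → j ℕ.< k →
                   ¬ (∀ v → v ≉ 0# → pow F v k ≈ 1# → pow F v j ≈ 1#)
  rootsOfUnity-⊈ {k} {j} (divides m M≡m*k) 0<j j<k ⊆ =
    ℕ.<⇒≱ m*j<M (order≤exponent (m ℕ.* j) {{ℕ.m*n≢0 m j}} w^[m*j]≈1)
    where
    instance
      m≢0 : NonZero m
      m≢0 = ℕ.≢-nonZero (λ m≡0 → order≢0 (≡.trans M≡m*k (≡.cong (ℕ._* k) m≡0)))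
      j≢0 : NonZero j
      j≢0 = >-nonZero 0<j

    m*j<M : m ℕ.* j ℕ.< M
    m*j<M = ≡.subst (m ℕ.* j ℕ.<_) (≡.sym M≡m*k) (ℕ.*-monoʳ-< m j<k)

    w^[m*j]≈1 : ∀ w → w ≉ 0# → pow F w (m ℕ.* j) ≈ 1#
    w^[m*j]≈1 w w≉0 = begin
      pow F w (m ℕ.* j)      ≈⟨ pow-assocʳ w m j ⟨
      pow F (pow F w m) j    ≈⟨ ⊆ (pow F w m) (pow-nonzero m w≉0) (begin
        pow F (pow F w m) k    ≈⟨ pow-assocʳ w m k ⟩
        pow F w (m ℕ.* k)      ≈⟨ pow-congʳ w M≡m*k ⟨
        pow F w M              ≈⟨ pow-order≈1 w w≉0 ⟩
        1#                     ∎) ⟩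
      1#                     ∎

pow-size≈self : ∀ {c ℓ} (F : Field c ℓ) {N} → HasSize F N → ∀ x → Field._≈_ F (pow F x N) x
pow-size≈self F {zero}  (_ , _ , onto) x with () ← proj₁ (onto x)
pow-size≈self F {suc M} size           x = FiniteFields.pow-size≈self F size x

module Subfields {c ℓ : Level} (F : Field c ℓ) (q : ℕ) where
  open Field F hiding (zero)
  open FieldProperties F
  open import Relation.Binary.Reasoning.Setoid setoid

  private
    In : ℕ → Carrier → Set ℓ
    In = InSubfield F q

  InSubfield-cong : ∀ k {x y} → x ≈ y → In k x → In k y
  InSubfield-cong k x≈y x∈k = trans (pow-congˡ (q ^ k) (sym x≈y)) (trans x∈k x≈y)

  pow-q^-+ : ∀ x a b → pow F x (q ^ (a ℕ.+ b)) ≈ pow F (pow F x (q ^ a)) (q ^ b)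
  pow-q^-+ x a b = trans (pow-congʳ x (ℕ.^-distribˡ-+-* q a b)) (sym (pow-assocʳ x (q ^ a) (q ^ b)))

  InSubfield-+ : ∀ {a b x} → In a x → In b x → In (a ℕ.+ b) x
  InSubfield-+ {a} {b} {x} x∈a x∈b = begin
    pow F x (q ^ (a ℕ.+ b))          ≈⟨ pow-q^-+ x a b ⟩
    pow F (pow F x (q ^ a)) (q ^ b)  ≈⟨ pow-congˡ (q ^ b) x∈a ⟩
    pow F x (q ^ b)                  ≈⟨ x∈b ⟩
    x                                ∎

  InSubfield-+⁻¹ : ∀ {a b s x} → a ℕ.+ b ≡ s → In s x → In b x → In a x
  InSubfield-+⁻¹ {a} {b} {s} {x} a+b≡s x∈s x∈b = begin
    pow F x (q ^ a)                  ≈⟨ pow-congˡ (q ^ a) x∈b ⟨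
    pow F (pow F x (q ^ b)) (q ^ a)  ≈⟨ pow-q^-+ x b a ⟨
    pow F x (q ^ (b ℕ.+ a))          ≈⟨ pow-congʳ x (≡.cong (q ^_) (≡.trans (ℕ.+-comm b a) a+b≡s)) ⟩
    pow F x (q ^ s)                  ≈⟨ x∈s ⟩
    x                                ∎

  InSubfield-* : ∀ m {a x} → In a x → In (m ℕ.* a) x
  InSubfield-* zero    {x = x} x∈a = *-identityʳ x
  InSubfield-* (suc m) {a}     x∈a = InSubfield-+ {a} {m ℕ.* a} x∈a (InSubfield-* m x∈a)

  InSubfield-∣ : ∀ {a b x} → a ∣ b → In a x → In b x
  InSubfield-∣ {x = x} (divides m ≡.refl) x∈a = InSubfield-* m x∈a

  InSubfield-gcd : ∀ {a b x} → In a x → In b x → In (gcd a b) x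
  InSubfield-gcd {a} {b} x∈a x∈b with Bézout.identity (gcd-GCD a b)
  ... | Bézout.+- s t eq = InSubfield-+⁻¹ {gcd a b} {t ℕ.* b} eq (InSubfield-* s {a} x∈a) (InSubfield-* t {b} x∈b)
  ... | Bézout.-+ s t eq = InSubfield-+⁻¹ {gcd a b} {s ℕ.* a} eq (InSubfield-* t {b} x∈b) (InSubfield-* s {a} x∈a)

  InSubfield⇔rootOfUnity : ∀ {k x} .{{_ : NonZero q}} → x ≉ 0# → In k x ⇔ pow F x (pred (q ^ k)) ≈ 1#
  InSubfield⇔rootOfUnity {k} {x} x≉0 = mk⇔
    (λ x∈k → pow-suc≈self⇒pow≈1 (pred (q ^ k)) x≉0 (trans (pow-congʳ x (≡.sym q^k≡1+K)) x∈k))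
    (λ x^K≈1 → trans (pow-congʳ x q^k≡1+K) (pow≈1⇒pow-suc≈self (pred (q ^ k)) x^K≈1))
    where
    q^k≡1+K : q ^ k ≡ suc (pred (q ^ k))
    q^k≡1+K = ≡.sym (ℕ.suc-pred (q ^ k) {{ℕ.m^n≢0 q k}})

[1+k]^m≡1+c*k : ∀ k m → ∃[ c ] suc k ^ m ≡ suc (c ℕ.* k)
[1+k]^m≡1+c*k k zero    = 0 , ≡.refl
[1+k]^m≡1+c*k k (suc m) with c , eq ← [1+k]^m≡1+c*k k m =
  suc (suc k ℕ.* c) , ≡.trans (≡.cong (suc k ℕ.*_) eq) (expand k c)
  where
  open import Data.Nat.Tactic.RingSolver using (solve-∀)
  expand : ∀ k c → suc k ℕ.* suc (c ℕ.* k) ≡ suc (suc (suc k ℕ.* c) ℕ.* k)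
  expand = solve-∀

pred[q^d]∣pred[q^n] : ∀ q {d n} .{{_ : NonZero q}} → d ∣ n → pred (q ^ d) ∣ pred (q ^ n)
pred[q^d]∣pred[q^n] q {d} (divides m ≡.refl) with c , eq ← [1+k]^m≡1+c*k (pred (q ^ d)) m =
  divides c (begin
    pred (q ^ (m ℕ.* d))            ≡⟨ ≡.cong pred (≡.cong (q ^_) (ℕ.*-comm m d)) ⟩
    pred (q ^ (d ℕ.* m))            ≡⟨ ≡.cong pred (ℕ.^-*-assoc q d m) ⟨
    pred ((q ^ d) ^ m)              ≡⟨ ≡.cong (λ Q → pred (Q ^ m)) (ℕ.suc-pred (q ^ d) {{ℕ.m^n≢0 q d}}) ⟨
    pred (suc (pred (q ^ d)) ^ m)   ≡⟨ ≡.cong pred eq ⟩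
    c ℕ.* pred (q ^ d)              ∎)
  where open ≡.≡-Reasoning

pred[q^m]<pred[q^n] : ∀ {q} → 1 ℕ.< q → ∀ {m n} → m ℕ.< n → pred (q ^ m) ℕ.< pred (q ^ n)
pred[q^m]<pred[q^n] {q} 1<q {m} m<n =
  ℕ.pred-mono-< {{ℕ.m^n≢0 q m {{>-nonZero (ℕ.<-trans ℕ.z<s 1<q)}}}} (ℕ.^-monoʳ-< q 1<q m<n)

primePower>1 : ∀ {q} → IsPrimePower q → 1 ℕ.< q
primePower>1 (p , k , p-prime , k≥1 , ≡.refl) =
  ℕ.^-monoʳ-< p (ℕ.nonTrivial⇒n>1 p {{prime⇒nonTrivial p-prime}}) {0} {k} k≥1

InSubfield-⊆⇒∣ : ∀ {c ℓ} (F : Field c ℓ) {q n d e} → 1 ℕ.< q → n ≥ 1 → HasSize F (q ^ n) → d ∣ n →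
                 (∀ w → Nonzero F w → InSubfield F q d w → InSubfield F q e w) → d ∣ e
InSubfield-⊆⇒∣ F {q} {n} {d} {e} 1<q n≥1 size d∣n ⊆ with gcd d e ℕ.≟ d
... | yes g≡d = ≡.subst (_∣ e) g≡d (gcd[m,n]∣n d e)
... | no  g≢d = ⊥-elim (FiniteFields.rootsOfUnity-⊈ F size′ (pred[q^d]∣pred[q^n] q d∣n)
                  (pred[q^m]<pred[q^n] 1<q 0<g) (pred[q^m]<pred[q^n] 1<q g<d) roots⊆)
  where
  open Field F hiding (zero)
  open Subfields F q
  open Equivalence using (to; from)
  instance
    q≢0 : NonZero q
    q≢0 = >-nonZero (ℕ.<-trans ℕ.z<s 1<q)

  g : ℕ
  g = gcd d e

  d≢0 : d ≢ 0
  d≢0 ≡.refl = ℕ.<⇒≢ n≥1 (≡.sym (0∣⇒≡0 d∣n))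

  0<g : 0 ℕ.< g
  0<g = ℕ.n≢0⇒n>0 (gcd[m,n]≢0 d e (inj₁ d≢0))

  g<d : g ℕ.< d
  g<d = ℕ.≤∧≢⇒< (∣⇒≤ {{ℕ.≢-nonZero d≢0}} (gcd[m,n]∣m d e)) g≢d

  size′ : HasSize F (suc (pred (q ^ n)))
  size′ = ≡.subst (HasSize F) (≡.sym (ℕ.suc-pred (q ^ n) {{ℕ.m^n≢0 q n}})) size

  roots⊆ : ∀ v → v ≉ 0# → pow F v (pred (q ^ d)) ≈ 1# → pow F v (pred (q ^ g)) ≈ 1#
  roots⊆ v v≉0 v^K≈1 = to (InSubfield⇔rootOfUnity {g} v≉0) (InSubfield-gcd {d} {e} v∈d (⊆ v v≉0 v∈d))
    where
    v∈d : InSubfield F q d v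
    v∈d = from (InSubfield⇔rootOfUnity {d} v≉0) v^K≈1

module Monomial {c ℓ : Level} (F : Field c ℓ) (q u : ℕ) where
  open Field F hiding (zero)
  open FieldProperties F
  open import Relation.Binary.Reasoning.Setoid setoid
  open import Algebra.Solver.Ring.NaturalCoefficients.Default commutativeSemiring
    using (solve; _:=_; _:*_)

  private
    f : Carrier → Carrier
    f = monomial F q u

  quot-≈⇒InSubfield : ∀ {y z} → y ≉ 0# → z ≉ 0# → quot F f y ≈ quot F f z → InSubfield F q u (y * z ⁻¹)
  quot-≈⇒InSubfield {y} {z} y≉0 z≉0 fy/y≈fz/z = begin
    pow F (y * z ⁻¹) Q                  ≈⟨ pow-distrib-* y (z ⁻¹) Q ⟩
    pow F y Q * pow F (z ⁻¹) Q          ≈⟨ *-congʳ (*-identityʳ _) ⟨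
    (pow F y Q * 1#) * pow F (z ⁻¹) Q   ≈⟨ *-congʳ (*-congˡ (⁻¹-inverseˡ y y≉0)) ⟨
    (pow F y Q * (y ⁻¹ * y)) * pow F (z ⁻¹) Q
      ≈⟨ solve 4 (λ a b c d → (a :* (b :* c)) :* d := ((a :* b) :* c) :* d) refl (pow F y Q) (y ⁻¹) y _ ⟩
    ((pow F y Q * y ⁻¹) * y) * pow F (z ⁻¹) Q
      ≈⟨ *-congʳ (*-congʳ fy/y≈fz/z) ⟩
    ((pow F z Q * z ⁻¹) * y) * pow F (z ⁻¹) Q
      ≈⟨ solve 4 (λ a b c d → ((a :* b) :* c) :* d := (c :* b) :* (a :* d)) refl (pow F z Q) (z ⁻¹) y _ ⟩
    (y * z ⁻¹) * (pow F z Q * pow F (z ⁻¹) Q)  ≈⟨ *-congˡ (pow-distrib-* z (z ⁻¹) Q) ⟨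
    (y * z ⁻¹) * pow F (z * z ⁻¹) Q     ≈⟨ *-congˡ (pow-congˡ Q (⁻¹-inverse z z≉0)) ⟩
    (y * z ⁻¹) * pow F 1# Q             ≈⟨ *-congˡ (pow-zeroˡ Q) ⟩
    (y * z ⁻¹) * 1#                     ≈⟨ *-identityʳ _ ⟩
    y * z ⁻¹                            ∎
    where
    Q : ℕ
    Q = q ^ u

  InSubfield⇒quot-≈-1# : ∀ {y} → y ≉ 0# → InSubfield F q u y → quot F f y ≈ quot F f 1#
  InSubfield⇒quot-≈-1# {y} y≉0 y∈u = begin
    pow F y (q ^ u) * y ⁻¹    ≈⟨ *-congʳ y∈u ⟩
    y * y ⁻¹                  ≈⟨ ⁻¹-inverse y y≉0 ⟩
    1#                        ≈⟨ ⁻¹-inverse 1# 1≉0 ⟨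
    1# * 1# ⁻¹                ≈⟨ *-congʳ (pow-zeroˡ (q ^ u)) ⟨
    pow F 1# (q ^ u) * 1# ⁻¹  ∎

module MonomialScattering {c ℓ : Level} (F : Field c ℓ) {q n : ℕ} (1<q : 1 ℕ.< q) (n≥1 : n ≥ 1)
                          (size : HasSize F (q ^ n)) (u : ℕ) where
  open Field F hiding (zero)
  open FieldProperties F
  open Subfields F q
  open Monomial F q u

  private
    f : Carrier → Carrier
    f = monomial F q u

    quot-≈-1# : ∀ {d w} → d ∣ u → w ≉ 0# → InSubfield F q d w → quot F f w ≈ quot F f 1#
    quot-≈-1# d∣u w≉0 w∈d = InSubfield⇒quot-≈-1# w≉0 (InSubfield-∣ d∣u w∈d)

    /1# : ∀ k {w} → InSubfield F q k (w * 1# ⁻¹) → InSubfield F q k w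
    /1# k = InSubfield-cong k (*-1⁻¹ _)

    quot-≈⇒InSubfield-gcd : ∀ {y z} → y ≉ 0# → z ≉ 0# → quot F f y ≈ quot F f z →
                            InSubfield F q (gcd u n) (y * z ⁻¹)
    quot-≈⇒InSubfield-gcd y≉0 z≉0 eq =
      InSubfield-gcd {u} {n} (quot-≈⇒InSubfield y≉0 z≉0 eq) (pow-size≈self F size _)

  LPartiallyScattered⇔ : ∀ t → LPartiallyScattered F q t f ⇔ gcd u n ∣ t
  LPartiallyScattered⇔ t = mk⇔
    (λ L → InSubfield-⊆⇒∣ F 1<q n≥1 size (gcd[m,n]∣n u n) λ w w≉0 w∈g →
      /1# t (L w 1# w≉0 1≉0 (quot-≈-1# (gcd[m,n]∣m u n) w≉0 w∈g)))
    (λ g∣t y z y≉0 z≉0 eq → InSubfield-∣ g∣t (quot-≈⇒InSubfield-gcd y≉0 z≉0 eq))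

  RPartiallyScattered⇔ : ∀ {t} → t ∣ n → RPartiallyScattered F q t f ⇔ gcd u t ≡ 1
  RPartiallyScattered⇔ {t} t∣n = mk⇔
    (λ R → ∣1⇒≡1 (InSubfield-⊆⇒∣ F 1<q n≥1 size (∣-trans (gcd[m,n]∣n u t) t∣n) λ w w≉0 w∈h →
      /1# 1 (R w 1# w≉0 1≉0 (quot-≈-1# (gcd[m,n]∣m u t) w≉0 w∈h)
                             (InSubfield-cong t (sym (*-1⁻¹ w)) (InSubfield-∣ (gcd[m,n]∣n u t) w∈h)))))
    (λ h≡1 y z y≉0 z≉0 eq y/z∈t → ≡.subst (λ k → InSubfield F q k (y * z ⁻¹)) h≡1
      (InSubfield-gcd {u} {t} (quot-≈⇒InSubfield y≉0 z≉0 eq) y/z∈t))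

  Scattered⇔ : Scattered F q f ⇔ gcd u n ≡ 1
  Scattered⇔ = mk⇔
    (λ S → ∣1⇒≡1 (InSubfield-⊆⇒∣ F 1<q n≥1 size (gcd[m,n]∣n u n) λ w w≉0 w∈g →
      /1# 1 (S w 1# w≉0 1≉0 (quot-≈-1# (gcd[m,n]∣m u n) w≉0 w∈g))))
    (λ g≡1 y z y≉0 z≉0 eq → ≡.subst (λ k → InSubfield F q k (y * z ⁻¹)) g≡1 (quot-≈⇒InSubfield-gcd y≉0 z≉0 eq))

proposition3p1 : ∀ {c ℓ} (F : Field c ℓ) (q n t u : ℕ) →
    IsPrimePower q → n ≥ 1 → t ≥ 1 → t ∣ n → u ≥ 1 →
    HasSize F (q ^ n) →
    (LPartiallyScattered F q t (monomial F q u) ⇔ gcd u n ∣ t)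
    × (RPartiallyScattered F q t (monomial F q u) ⇔ gcd u t ≡ 1)
    × (Scattered F q (monomial F q u) ⇔ gcd u n ≡ 1)
proposition3p1 F q n t u q-primePower n≥1 _ t∣n _ size =
  LPartiallyScattered⇔ t , RPartiallyScattered⇔ t∣n , Scattered⇔
  where open MonomialScattering F (primePower>1 q-primePower) n≥1 size u
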